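{- Let $k\ge 1$ be an integer. If $G$ is a connected graph with $\mathrm{diam}(G)\le 2k+1$, then $\mathrm{gp}(G)\ge \alpha_k(G)$.
   Context: A set $S$ of vertices of $G$ is a $k$-packing if $d_G(u,v)>k$ for all distinct $u,v\in S$; $\alpha_k(G)$ is the maximum cardinality of a $k$-packing of $G$. A set of vertices is a general position set if no three distinct vertices of it lie on a common geodesic (shortest path) of $G$; $\mathrm{gp}(G)$ is the maximum cardinality of a general position set. $\mathrm{diam}(G)$ is the diameter of $G$. -}

module Defs where

open import Data.Nat using (ℕ; zero; suc; _+_; _≤_; _<_)
open import Data.Fin using (Fin; zero; suc; inject₁; fromℕ)
open import Data.Fin.Subset using (Subset; _∈_; ∣_∣)
open import Data.Product using (Σ; ∃; _×_; _,_)
open import Relation.Binary.PropositionalEquality using (_≡_; _≢_)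
open import Relation.Nullary using (¬_)
open import Level using (0ℓ)

record Graph (n : ℕ) : Set₁ where
  field
    Adj     : Fin n → Fin n → Set
    symm    : ∀ {u v} → Adj u v → Adj v u
    irrefl  : ∀ {u} → ¬ Adj u u

module _ {n : ℕ} (G : Graph n) where
  open Graph G

  Walk : ℕ → Set
  Walk ℓ = Σ (Fin (suc ℓ) → Fin n) λ p → ∀ (i : Fin ℓ) → Adj (p (inject₁ i)) (p (suc i))

  WalkFromTo : (ℓ : ℕ) → Walk ℓ → Fin n → Fin n → Set
  WalkFromTo ℓ (p , _) u v = (p zero ≡ u) × (p (fromℕ ℓ) ≡ v)

  OnWalk : {ℓ : ℕ} → Fin n → Walk ℓ → Set
  OnWalk {ℓ} x (p , _) = ∃ λ (i : Fin (suc ℓ)) → p i ≡ x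

  Connected : Set
  Connected = ∀ u v → ∃ λ ℓ → Σ (Walk ℓ) λ w → WalkFromTo ℓ w u v

  Dist : Fin n → Fin n → ℕ → Set
  Dist u v d = (Σ (Walk d) λ w → WalkFromTo d w u v)
             × (∀ ℓ (w : Walk ℓ) → WalkFromTo ℓ w u v → d ≤ ℓ)

  DiamAtMost : ℕ → Set
  DiamAtMost D = ∀ u v d → Dist u v d → d ≤ D

  IsGeodesic : (ℓ : ℕ) → Walk ℓ → Set
  IsGeodesic ℓ w = ∃ λ u → ∃ λ v → WalkFromTo ℓ w u v × Dist u v ℓ

  IsGPSet : Subset n → Set
  IsGPSet S = ∀ x y z → x ∈ S → y ∈ S → z ∈ S → x ≢ y → y ≢ z → x ≢ z →
              ∀ ℓ (w : Walk ℓ) → IsGeodesic ℓ w →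
              ¬ (OnWalk x w × OnWalk y w × OnWalk z w)

  IsPacking : ℕ → Subset n → Set
  IsPacking k S = ∀ u v → u ∈ S → v ∈ S → u ≢ v → ∀ d → Dist u v d → k < d

IsMaximum : (ℕ → Set) → ℕ → Set
IsMaximum P m = P m × (∀ m' → P m' → m' ≤ m)

IsGPNumber : {n : ℕ} → Graph n → ℕ → Set
IsGPNumber G = IsMaximum (λ m → ∃ λ S → IsGPSet G S × ∣ S ∣ ≡ m)

IsPackingNumber : {n : ℕ} → ℕ → Graph n → ℕ → Set
IsPackingNumber k G = IsMaximum (λ m → ∃ λ S → IsPacking G k S × ∣ S ∣ ≡ m)

-- On a geodesic, the distance between two of its vertices is the distance
-- along the geodesic.  If three vertices of a k-packing lay on a common
-- geodesic, the middle one would be at distance > k from each of the outer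
-- ones, so the outer two would be at distance ≥ 2k + 2 > diam(G).  Hence every
-- k-packing is in general position, and gp(G) ≥ α_k(G).
module Submission where

open import Defs
open import Data.Nat using (ℕ; zero; suc; _+_; _*_; _≤_; _≥_; _<_; _≤?_; z≤n; s≤s)
open import Data.Nat.Properties
open import Data.Fin using (Fin; toℕ; fromℕ; fromℕ<; inject₁)
open import Data.Fin.Properties using (toℕ-injective; toℕ<n; toℕ-fromℕ; toℕ-fromℕ<; toℕ-inject₁)
open import Data.Fin.Subset using (Subset; _∈_)
open import Data.Product using (∃; _×_; _,_; proj₁; proj₂)
open import Data.Sum using (inj₁; inj₂)
open import Relation.Binary.PropositionalEquality
open import Function using (_∘_)
open import Relation.Nullary using (¬_; yes; no; contradiction)

2*k+1<m+n : ∀ {k m n} → k < m → k < n → 2 * k + 1 < m + n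
2*k+1<m+n {k} {m} {n} k<m k<n = begin-strict
  2 * k + 1       ≡⟨ cong (_+ 1) (cong (k +_) (+-identityʳ k)) ⟩
  k + k + 1       ≡⟨ +-comm (k + k) 1 ⟩
  suc (k + k)     <⟨ s≤s (≤-reflexive (sym (+-suc k k))) ⟩
  suc k + suc k   ≤⟨ +-mono-≤ k<m k<n ⟩
  m + n           ∎
  where open ≤-Reasoning

module _ {Q : ℕ → ℕ → ℕ → Set}
         (swap₁₂ : ∀ {a b c} → Q a b c → Q b a c)
         (swap₂₃ : ∀ {a b c} → Q a b c → Q a c b)
         (¬sorted : ∀ r d₁ d₂ → ¬ Q r (r + d₁) (r + d₁ + d₂)) where

  private
    ¬ordered : ∀ {r s t} → r ≤ s → s ≤ t → ¬ Q r s t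
    ¬ordered r≤s s≤t with m≤n⇒∃[o]m+o≡n r≤s | m≤n⇒∃[o]m+o≡n s≤t
    ... | d₁ , refl | d₂ , refl = ¬sorted _ d₁ d₂

    ¬smallest-first : ∀ {a b c} → a ≤ b → ¬ Q a b c
    ¬smallest-first {a} {b} {c} a≤b q with ≤-total b c | ≤-total a c
    ... | inj₁ b≤c | _        = ¬ordered a≤b b≤c q
    ... | inj₂ c≤b | inj₁ a≤c = ¬ordered a≤c c≤b (swap₂₃ q)
    ... | inj₂ c≤b | inj₂ c≤a = ¬ordered c≤a a≤b (swap₁₂ (swap₂₃ q))

  ¬symmetric-triple : ∀ a b c → ¬ Q a b c
  ¬symmetric-triple a b c q with ≤-total a b
  ... | inj₁ a≤b = ¬smallest-first a≤b q
  ... | inj₂ b≤a = ¬smallest-first b≤a (swap₁₂ q)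

module _ {A : Set} where

  append : ℕ → (ℕ → A) → (ℕ → A) → ℕ → A
  append zero    P Q i       = Q i
  append (suc a) P Q zero    = P zero
  append (suc a) P Q (suc i) = append a (P ∘ suc) Q i

  append-start : ∀ a P Q → P a ≡ Q 0 → append a P Q 0 ≡ P 0
  append-start zero    P Q Pa≡Q0 = sym Pa≡Q0
  append-start (suc a) P Q Pa≡Q0 = refl

  append-shift : ∀ a P Q b → append a P Q (a + b) ≡ Q b
  append-shift zero    P Q b = refl
  append-shift (suc a) P Q b = append-shift a (P ∘ suc) Q b

-- Walks are handled as sequences ℕ → Fin n (values beyond the length are
-- junk), which makes cutting and concatenating them index arithmetic on ℕ.
module _ {n : ℕ} (G : Graph n) where
  open Graph G

  IsWalkSeq : ℕ → (ℕ → Fin n) → Set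
  IsWalkSeq ℓ P = ∀ i → i < ℓ → Adj (P i) (P (suc i))

  WalkSeqFromTo : ℕ → (ℕ → Fin n) → Fin n → Fin n → Set
  WalkSeqFromTo ℓ P u v = IsWalkSeq ℓ P × P 0 ≡ u × P ℓ ≡ v

  toWalk : ∀ {ℓ P} → IsWalkSeq ℓ P → Walk G ℓ
  toWalk {ℓ} {P} adj = (λ j → P (toℕ j)) , λ i →
    subst (λ t → Adj (P t) (P (suc (toℕ i)))) (sym (toℕ-inject₁ i)) (adj (toℕ i) (toℕ<n i))

  toWalk-fromTo : ∀ {ℓ P u v} (p : WalkSeqFromTo ℓ P u v) → WalkFromTo G ℓ (toWalk (proj₁ p)) u v
  toWalk-fromTo {ℓ} {P} (_ , P0≡u , Pℓ≡v) = P0≡u , trans (cong P (toℕ-fromℕ ℓ)) Pℓ≡v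

  toSeq : ∀ {ℓ} → Walk G ℓ → ℕ → Fin n
  toSeq {ℓ} (p , _) i with i ≤? ℓ
  ... | yes i≤ℓ = p (fromℕ< (s≤s i≤ℓ))
  ... | no _    = p Data.Fin.zero

  toSeq-toℕ : ∀ {ℓ} (w : Walk G ℓ) j → toSeq w (toℕ j) ≡ proj₁ w j
  toSeq-toℕ {ℓ} (p , _) j with toℕ j ≤? ℓ
  ... | yes j≤ℓ = cong p (toℕ-injective (toℕ-fromℕ< (s≤s j≤ℓ)))
  ... | no j≰ℓ  = contradiction (≤-pred (toℕ<n j)) j≰ℓ

  toSeq-isWalk : ∀ {ℓ} (w : Walk G ℓ) → IsWalkSeq ℓ (toSeq w)
  toSeq-isWalk w i i<ℓ =
    subst₂ Adj (sym (trans (cong (toSeq w) toℕ-j) (toSeq-toℕ w (inject₁ j))))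
               (sym (trans (cong (toSeq w ∘ suc) toℕ-j′) (toSeq-toℕ w (Data.Fin.suc j))))
               (proj₂ w j)
    where
      j = fromℕ< i<ℓ
      toℕ-j′ : i ≡ toℕ j
      toℕ-j′ = sym (toℕ-fromℕ< i<ℓ)
      toℕ-j : i ≡ toℕ (inject₁ j)
      toℕ-j = trans toℕ-j′ (sym (toℕ-inject₁ j))

  toSeq-fromTo : ∀ {ℓ u v} (w : Walk G ℓ) → WalkFromTo G ℓ w u v → WalkSeqFromTo ℓ (toSeq w) u v
  toSeq-fromTo {ℓ} w (w0≡u , wℓ≡v) =
    toSeq-isWalk w ,
    trans (toSeq-toℕ w Data.Fin.zero) w0≡u ,
    trans (cong (toSeq w) (sym (toℕ-fromℕ ℓ))) (trans (toSeq-toℕ w (fromℕ ℓ)) wℓ≡v)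

  dist-minimal : ∀ {u v d ℓ P} → Dist G u v d → WalkSeqFromTo ℓ P u v → d ≤ ℓ
  dist-minimal {ℓ = ℓ} (_ , minimal) p = minimal ℓ (toWalk (proj₁ p)) (toWalk-fromTo p)

  dist-intro : ∀ {u v d P} → WalkSeqFromTo d P u v →
               (∀ {ℓ Q} → WalkSeqFromTo ℓ Q u v → d ≤ ℓ) → Dist G u v d
  dist-intro p minimal = (toWalk (proj₁ p) , toWalk-fromTo p) , λ ℓ w q → minimal (toSeq-fromTo w q)

  append-isWalk : ∀ a {b P Q} → IsWalkSeq a P → IsWalkSeq b Q → P a ≡ Q 0 →
                  IsWalkSeq (a + b) (append a P Q)
  append-isWalk zero    P-walk Q-walk Pa≡Q0 i       i<b = Q-walk i i<b
  append-isWalk (suc a) {P = P} {Q} P-walk Q-walk Pa≡Q0 zero _ =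
    subst (Adj (P 0)) (sym (append-start a (P ∘ suc) Q Pa≡Q0)) (P-walk 0 (s≤s z≤n))
  append-isWalk (suc a) P-walk Q-walk Pa≡Q0 (suc i) (s≤s i<a+b) =
    append-isWalk a (λ j j<a → P-walk (suc j) (s≤s j<a)) Q-walk Pa≡Q0 i i<a+b

  take-isWalk : ∀ {a ℓ P} → a ≤ ℓ → IsWalkSeq ℓ P → IsWalkSeq a P
  take-isWalk a≤ℓ P-walk i i<a = P-walk i (≤-trans i<a a≤ℓ)

  drop-isWalk : ∀ a {d P} → IsWalkSeq (a + d) P → IsWalkSeq d (P ∘ (a +_))
  drop-isWalk a {P = P} P-walk i i<d =
    subst (Adj (P (a + i)) ∘ P) (sym (+-suc a i)) (P-walk (a + i) (+-monoʳ-< a i<d))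

  replace-segment : ∀ {ℓ P u v a d e ℓ′ Q} → WalkSeqFromTo ℓ P u v → a + d + e ≡ ℓ →
                    WalkSeqFromTo ℓ′ Q (P a) (P (a + d)) →
                    ∃ λ R → WalkSeqFromTo (a + ℓ′ + e) R u v
  replace-segment {ℓ} {P} {a = a} {d} {e} {ℓ′} {Q}
    (P-walk , P0≡u , Pℓ≡v) a+d+e≡ℓ (Q-walk , Q0≡Pa , Qℓ′≡Pa+d) =
    append (a + ℓ′) prefix suffix ,
    append-isWalk (a + ℓ′) prefix-walk suffix-walk junction ,
    trans (append-start (a + ℓ′) prefix suffix junction) (trans (append-start a P Q (sym Q0≡Pa)) P0≡u) ,
    trans (append-shift (a + ℓ′) prefix suffix e) (trans (cong P a+d+e≡ℓ) Pℓ≡v)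
    where
      prefix = append a P Q
      suffix = P ∘ (a + d +_)
      a≤ℓ : a ≤ ℓ
      a≤ℓ = ≤-trans (m≤m+n a d) (subst (a + d ≤_) a+d+e≡ℓ (m≤m+n (a + d) e))
      prefix-walk : IsWalkSeq (a + ℓ′) prefix
      prefix-walk = append-isWalk a (take-isWalk a≤ℓ P-walk) Q-walk (sym Q0≡Pa)
      suffix-walk : IsWalkSeq e suffix
      suffix-walk = drop-isWalk (a + d) (subst (λ m → IsWalkSeq m P) (sym a+d+e≡ℓ) P-walk)
      junction : prefix (a + ℓ′) ≡ suffix 0
      junction = trans (append-shift a P Q ℓ′) (trans Qℓ′≡Pa+d (cong P (sym (+-identityʳ (a + d)))))

  segment-dist : ∀ {ℓ P u v} a d → WalkSeqFromTo ℓ P u v → Dist G u v ℓ → a + d ≤ ℓ →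
                 Dist G (P a) (P (a + d)) d
  segment-dist {ℓ} {P} a d p@(P-walk , _) uv-dist a+d≤ℓ with m≤n⇒∃[o]m+o≡n a+d≤ℓ
  ... | e , a+d+e≡ℓ =
    dist-intro (drop-isWalk a (take-isWalk a+d≤ℓ P-walk) , cong P (+-identityʳ a) , refl) shortest
    where
      shortest : ∀ {ℓ′ Q} → WalkSeqFromTo ℓ′ Q (P a) (P (a + d)) → d ≤ ℓ′
      shortest {ℓ′} q with replace-segment p a+d+e≡ℓ q
      ... | _ , r = +-cancelˡ-≤ a d ℓ′ (+-cancelʳ-≤ e (a + d) (a + ℓ′)
                      (subst (_≤ a + ℓ′ + e) (sym a+d+e≡ℓ) (dist-minimal uv-dist r)))

  module _ (S : Subset n) (ℓ : ℕ) (P : ℕ → Fin n) where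

    InSetAt : ℕ → Set
    InSetAt i = i ≤ ℓ × P i ∈ S

    DistinctInSetAt : ℕ → ℕ → ℕ → Set
    DistinctInSetAt a b c = InSetAt a × InSetAt b × InSetAt c × P a ≢ P b × P b ≢ P c × P a ≢ P c

    distinctInSetAt-swap₁₂ : ∀ {a b c} → DistinctInSetAt a b c → DistinctInSetAt b a c
    distinctInSetAt-swap₁₂ (a∈ , b∈ , c∈ , a≢b , b≢c , a≢c) = b∈ , a∈ , c∈ , ≢-sym a≢b , a≢c , b≢c

    distinctInSetAt-swap₂₃ : ∀ {a b c} → DistinctInSetAt a b c → DistinctInSetAt a c b
    distinctInSetAt-swap₂₃ (a∈ , b∈ , c∈ , a≢b , b≢c , a≢c) = a∈ , c∈ , b∈ , a≢c , ≢-sym b≢c , a≢b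

  packing-¬sorted-on-geodesic : ∀ {k S ℓ P u v} → IsPacking G k S → DiamAtMost G (2 * k + 1) →
                                WalkSeqFromTo ℓ P u v → Dist G u v ℓ →
                                ∀ r d₁ d₂ → ¬ DistinctInSetAt S ℓ P r (r + d₁) (r + d₁ + d₂)
  packing-¬sorted-on-geodesic {ℓ = ℓ} {P} packing diam geodesic uv-dist r d₁ d₂
    ((_ , r∈S) , (s≤ℓ , s∈S) , (t≤ℓ , t∈S) , r≢s , s≢t , _) =
    <⇒≱ (2*k+1<m+n k<d₁ k<d₂) (diam _ _ (d₁ + d₂) rt-dist)
    where
      k<d₁ = packing _ _ r∈S s∈S r≢s d₁ (segment-dist r d₁ geodesic uv-dist s≤ℓ)
      k<d₂ = packing _ _ s∈S t∈S s≢t d₂ (segment-dist (r + d₁) d₂ geodesic uv-dist t≤ℓ)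
      rt-dist : Dist G (P r) (P (r + d₁ + d₂)) (d₁ + d₂)
      rt-dist = subst (λ m → Dist G (P r) (P m) (d₁ + d₂)) (sym (+-assoc r d₁ d₂))
                  (segment-dist r (d₁ + d₂) geodesic uv-dist (subst (_≤ ℓ) (+-assoc r d₁ d₂) t≤ℓ))

  onWalk⇒position : ∀ {ℓ x} (w : Walk G ℓ) → OnWalk G x w → ∃ λ i → i ≤ ℓ × toSeq w i ≡ x
  onWalk⇒position w (j , wj≡x) = toℕ j , ≤-pred (toℕ<n j) , trans (toSeq-toℕ w j) wj≡x

  packing⇒gpSet : ∀ {k S} → IsPacking G k S → DiamAtMost G (2 * k + 1) → IsGPSet G S
  packing⇒gpSet {S = S} packing diam x y z x∈S y∈S z∈S x≢y y≢z x≢z ℓ w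
    (u , v , w-uv , uv-dist) (x-on , y-on , z-on)
    with onWalk⇒position w x-on | onWalk⇒position w y-on | onWalk⇒position w z-on
  ... | a , a≤ℓ , refl | b , b≤ℓ , refl | c , c≤ℓ , refl =
    ¬symmetric-triple (distinctInSetAt-swap₁₂ S ℓ P) (distinctInSetAt-swap₂₃ S ℓ P)
      (packing-¬sorted-on-geodesic packing diam (toSeq-fromTo w w-uv) uv-dist) a b c
      ((a≤ℓ , x∈S) , (b≤ℓ , y∈S) , (c≤ℓ , z∈S) , x≢y , y≢z , x≢z)
    where P = toSeq w

corollary4p2 : (k : ℕ) → 1 ≤ k → (n : ℕ) → (G : Graph n) → Connected G →
               DiamAtMost G (2 * k + 1) →
               ∀ gp α → IsGPNumber G gp → IsPackingNumber k G α → gp ≥ α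
corollary4p2 k _ n G _ diam gp α (_ , gp-maximum) ((S , packing , ∣S∣≡α) , _) =
  gp-maximum α (S , packing⇒gpSet G packing diam , ∣S∣≡α)
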